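{- Let $R$ be a finite commutative chain ring with maximal ideal $\mathfrak{m}$, residue field $R/\mathfrak{m}\cong\mathbb{F}_q$ and nilpotency index $\nu$ of $\mathfrak{m}$. Let $E$ be a finite set and $C\le R^E$ a free $R$-code with $\mu_R(C)=k$. If $M(C)$ is a simple matroid, then $$|E|\le\frac{q^{\nu k}-q^{(\nu-1)k}}{q^\nu-q^{\nu-1}}=q^{(\nu-1)(k-1)}\frac{q^k-1}{q-1}.$$
   Context: $\mu_R(C)=\dim_{R/\mathfrak{m}}(C/\mathfrak{m}C)$. Vectors are modular independent if $\sum\alpha_iv_i=0$ implies all $\alpha_i\in\mathfrak{m}$. $M(C)$ is the independence system on $E$ whose independent sets are the $I\subseteq E$ such that the columns indexed by $I$ of a generator matrix of $C$ (rows forming a minimal generating set of $C$) are modular independent. A matroid is simple if it has no loops (one-element circuits) and no parallel elements (two-element circuits). -}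

module Defs where

open import Level using (Level; _⊔_)
open import Algebra.Bundles using (CommutativeRing)
open import Data.Nat using (ℕ; zero; suc; _<_; _≤_)
open import Data.Fin using (Fin; zero; suc; _≟_)
open import Data.Fin.Subset using (Subset; _∈_; _∉_; ⁅_⁆; _∪_)
open import Data.Product using (Σ; ∃; ∃-syntax; _×_; _,_)
open import Data.Sum using (_⊎_)
open import Relation.Nullary using (¬_)
open import Relation.Binary.PropositionalEquality using (_≡_)
open import Relation.Unary using (Pred; _⊆_)

module _ {c ℓ : Level} (R : CommutativeRing c ℓ) where
  open CommutativeRing R using (Carrier; _≈_; _+_; _*_; _-_; 0#; 1#)

  Σᶠ : {t : ℕ} → (Fin t → Carrier) → Carrier
  Σᶠ {zero}  f = 0#
  Σᶠ {suc t} f = f zero + Σᶠ (λ i → f (suc i))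

  Πᶠ : {t : ℕ} → (Fin t → Carrier) → Carrier
  Πᶠ {zero}  f = 1#
  Πᶠ {suc t} f = f zero * Πᶠ (λ i → f (suc i))

  IsFiniteRing : Set (c ⊔ ℓ)
  IsFiniteRing = ∃[ N ] Σ (Fin N → Carrier) λ f → ∀ x → ∃[ i ] (f i ≈ x)

  record IsIdeal (I : Pred Carrier (c ⊔ ℓ)) : Set (c ⊔ ℓ) where
    field
      resp  : ∀ {x y} → x ≈ y → I x → I y
      zero∈ : I 0#
      +-cl  : ∀ {x y} → I x → I y → I (x + y)
      *-cl  : ∀ r {x} → I x → I (r * x)

  IsChainRing : Set (Level.suc (c ⊔ ℓ))
  IsChainRing = (I J : Pred Carrier (c ⊔ ℓ)) → IsIdeal I → IsIdeal J → I ⊆ J ⊎ J ⊆ I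

  record IsMaximalIdeal (𝔪 : Pred Carrier (c ⊔ ℓ)) : Set (Level.suc (c ⊔ ℓ)) where
    field
      ideal   : IsIdeal 𝔪
      proper  : ¬ 𝔪 1#
      maximal : (J : Pred Carrier (c ⊔ ℓ)) → IsIdeal J → 𝔪 ⊆ J → J ⊆ 𝔪 ⊎ J 1#

  -- |R/𝔪| = q : a complete system of q pairwise incongruent residues mod 𝔪
  ResidueFieldCard : Pred Carrier (c ⊔ ℓ) → ℕ → Set (c ⊔ ℓ)
  ResidueFieldCard 𝔪 q = Σ (Fin q → Carrier) λ r →
    (∀ i j → 𝔪 (r i - r j) → i ≡ j) × (∀ x → ∃[ i ] 𝔪 (x - r i))

  -- 𝔪^j = 0 : every product of j elements of 𝔪 vanishes
  -- (𝔪^j is generated by such products)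
  PowZero : Pred Carrier (c ⊔ ℓ) → ℕ → Set (c ⊔ ℓ)
  PowZero 𝔪 j = (xs : Fin j → Carrier) → (∀ i → 𝔪 (xs i)) → Πᶠ xs ≈ 0#

  NilpotencyIndex : Pred Carrier (c ⊔ ℓ) → ℕ → Set (c ⊔ ℓ)
  NilpotencyIndex 𝔪 ν = PowZero 𝔪 ν × (∀ j → PowZero 𝔪 j → ν ≤ j)

  Vecᴿ : ℕ → Set c
  Vecᴿ n = Fin n → Carrier

  _≈ᵛ_ : {n : ℕ} → Vecᴿ n → Vecᴿ n → Set ℓ
  u ≈ᵛ v = ∀ e → u e ≈ v e

  lin : {n t : ℕ} → (Fin t → Carrier) → (Fin t → Vecᴿ n) → Vecᴿ n
  lin α v e = Σᶠ (λ i → α i * v i e)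

  record IsSubmodule {n : ℕ} (C : Pred (Vecᴿ n) (c ⊔ ℓ)) : Set (c ⊔ ℓ) where
    field
      resp  : ∀ {u v} → u ≈ᵛ v → C u → C v
      zero∈ : C (λ _ → 0#)
      +-cl  : ∀ {u v} → C u → C v → C (λ e → u e + v e)
      *-cl  : ∀ r {u} → C u → C (λ e → r * u e)

  IsFree : {n : ℕ} → Pred (Vecᴿ n) (c ⊔ ℓ) → Set (c ⊔ ℓ)
  IsFree {n} C = ∃[ r ] Σ (Fin r → Vecᴿ n) λ b →
      (∀ i → C (b i))
    × (∀ α → lin α b ≈ᵛ (λ _ → 0#) → ∀ i → α i ≈ 0#)
    × (∀ u → C u → ∃[ α ] (u ≈ᵛ lin α b))

  In𝔪C : {n : ℕ} → Pred Carrier (c ⊔ ℓ) → Pred (Vecᴿ n) (c ⊔ ℓ) → Vecᴿ n → Set (c ⊔ ℓ)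
  In𝔪C {n} 𝔪 C x = ∃[ t ] Σ (Fin t → Carrier) λ a → Σ (Fin t → Vecᴿ n) λ w →
    (∀ i → 𝔪 (a i)) × (∀ i → C (w i)) × (x ≈ᵛ lin a w)

  -- μ_R(C) = k : dim_{R/𝔪}(C/𝔪C) = k, i.e. C/𝔪C has an R/𝔪-basis of size k
  -- (given by lifts v_i ∈ C; scalars of R/𝔪 given by lifts α_i ∈ R)
  Mu : {n : ℕ} → Pred Carrier (c ⊔ ℓ) → Pred (Vecᴿ n) (c ⊔ ℓ) → ℕ → Set (c ⊔ ℓ)
  Mu {n} 𝔪 C k = Σ (Fin k → Vecᴿ n) λ v →
      (∀ i → C (v i))
    × (∀ α → In𝔪C 𝔪 C (lin α v) → ∀ i → 𝔪 (α i))
    × (∀ u → C u → ∃[ α ] In𝔪C 𝔪 C (λ e → u e - lin α v e))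

  record IsMinimalGeneratorMatrix {n m : ℕ} (C : Pred (Vecᴿ n) (c ⊔ ℓ))
         (G : Fin m → Vecᴿ n) : Set (c ⊔ ℓ) where
    field
      rows∈     : ∀ i → C (G i)
      generates : ∀ u → C u → ∃[ α ] (u ≈ᵛ lin α G)
      minimal   : ∀ i → ¬ (∀ u → C u → ∃[ α ] (α i ≈ 0# × u ≈ᵛ lin α G))

  -- M(C): I ⊆ E independent iff the columns of G indexed by I are
  -- modular independent: Σ_{e∈I} α_e G_{·e} = 0 ⇒ α_e ∈ 𝔪 for all e ∈ I
  ModIndep : {n m : ℕ} → Pred Carrier (c ⊔ ℓ) → (Fin m → Vecᴿ n) → Subset n → Set (c ⊔ ℓ)
  ModIndep {n} 𝔪 G I = (α : Fin n → Carrier) → (∀ e → e ∉ I → α e ≈ 0#) →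
    (∀ r → Σᶠ (λ e → α e * G r e) ≈ 0#) → ∀ e → e ∈ I → 𝔪 (α e)

module _ {a : Level} {n : ℕ} (Indep : Subset n → Set a) where

  IsLoop : Fin n → Set a
  IsLoop e = ¬ Indep ⁅ e ⁆

  IsParallel : Fin n → Fin n → Set a
  IsParallel e f = ¬ (e ≡ f) × ¬ Indep (⁅ e ⁆ ∪ ⁅ f ⁆) × Indep ⁅ e ⁆ × Indep ⁅ f ⁆

  IsSimple : Set a
  IsSimple = (∀ e → ¬ IsLoop e) × (∀ e f → ¬ IsParallel e f)

{-# OPTIONS --safe #-}
-- As R is a finite chain ring, 𝔪 = πR is principal and π^ν = 0. Every element has a unique
-- π-adic expansion with ν digits from a system of residues, so |R| = q^ν and the units, the
-- elements with nonzero leading digit, number q^ν − q^(ν−1). By Nakayama's lemma lifts v of a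
-- basis of C/𝔪C generate C, so every linear relation among the columns of v also holds among the
-- columns of G. Divisibility in R is total, hence each column of v is s_e·y_e where y_e has an
-- entry 1. For units u, u′ and e ≠ f, u·y_e = u′·y_f would make columns e and f proportional with
-- a unit coefficient (one of s_e, s_f divides the other), i.e. parallel in M(C); for e = f the
-- entry 1 gives u = u′. So (e, u) ↦ u·y_e injects E × R^× into the vectors of R^k with a unit
-- entry, of which there are q^(νk) − q^((ν−1)k). When k = 0 every column is a loop, so E = ∅.
module Submission where

open import Defs
open import Level using (Level; _⊔_)
open import Algebra.Bundles using (CommutativeRing)
open import Data.Nat using (ℕ; _*_; _∸_; _^_; _≤_)
open import Data.Fin using (Fin)
open import Relation.Unary using (Pred)

open import Data.Nat using (zero; suc; z≤n; _<_)
import Data.Nat as ℕ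
import Data.Nat.Properties as ℕₚ
open import Data.Fin using (zero; suc; _≟_; punchIn; punchOut; combine; remQuot; funToFin; finToFun)
open import Data.Fin.Properties
  using ( combine-injective; combine-remQuot; funToFin-finToFin; finToFun-funToFin; injective⇒≤
        ; punchOut-injective; punchIn-injective; punchInᵢ≢i )
open import Data.Fin.Subset using (Subset; _∈_; _∉_; ⁅_⁆; _∪_)
open import Data.Fin.Subset.Properties using (x∈⁅x⁆; x∈p∪q⁺)
open import Data.Product using (_×_; _,_; proj₁; proj₂; map₂; uncurry; ∃-syntax)
open import Data.Product.Properties using (×-≡,≡→≡)
open import Function using (_∘_; Injective)
open import Data.Sum using (_⊎_; inj₁; inj₂)
open import Data.Empty using (⊥-elim)
open import Data.Vec.Functional using (_∷_)
open import Relation.Nullary using (¬_; yes; no; map′; contradiction)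
open import Relation.Unary using (Decidable)
open import Relation.Binary.PropositionalEquality as ≡ using (_≡_; _≢_; _≗_)

funToFin-cong : ∀ {m n} {f g : Fin m → Fin n} → f ≗ g → funToFin f ≡ funToFin g
funToFin-cong {zero}  f≗g = ≡.refl
funToFin-cong {suc m} f≗g = ≡.cong₂ combine (f≗g zero) (funToFin-cong (f≗g ∘ suc))

funToFin-injective : ∀ {m n} {f g : Fin m → Fin n} → funToFin f ≡ funToFin g → f ≗ g
funToFin-injective {f = f} {g} eq i = begin
  f i                     ≡⟨ finToFun-funToFin f i ⟨
  finToFun (funToFin f) i ≡⟨ ≡.cong (λ x → finToFun x i) eq ⟩
  finToFun (funToFin g) i ≡⟨ finToFun-funToFin g i ⟩
  g i                     ∎
  where open ≡.≡-Reasoning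

finToFun-injective : ∀ {m n} {i j : Fin (m ^ n)} → finToFun i ≗ finToFun j → i ≡ j
finToFun-injective {m} {n} {i} {j} eq = begin
  i                             ≡⟨ funToFin-finToFin {n} {m} i ⟨
  funToFin (finToFun {m} {n} i) ≡⟨ funToFin-cong {n} {m} eq ⟩
  funToFin (finToFun {m} {n} j) ≡⟨ funToFin-finToFin {n} {m} j ⟩
  j                             ∎
  where open ≡.≡-Reasoning

remQuot-injective : ∀ {m} n {i j : Fin (m * n)} → remQuot n i ≡ remQuot n j → i ≡ j
remQuot-injective {m} n {i} {j} eq = begin
  i                                 ≡⟨ combine-remQuot {m} n i ⟨
  uncurry combine (remQuot {m} n i) ≡⟨ ≡.cong (uncurry (combine {m})) eq ⟩
  uncurry combine (remQuot {m} n j) ≡⟨ combine-remQuot {m} n j ⟩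
  j                                 ∎
  where open ≡.≡-Reasoning

injective-avoiding⇒≤ : ∀ {a b B} (F : Fin a → Fin b × Fin B) → Injective _≡_ _≡_ F →
                       (c : Fin b) → (∀ x → proj₁ (F x) ≢ c) → a ≤ (b ∸ 1) * B
injective-avoiding⇒≤ {a} {suc b} {B} F F-injective c avoids = injective⇒≤ G-injective
  where
  G : Fin a → Fin (b * B)
  G x = combine (punchOut (avoids x ∘ ≡.sym)) (proj₂ (F x))

  G-injective : Injective _≡_ _≡_ G
  G-injective {x} {y} eq with p , q ← combine-injective _ _ _ _ eq =
    F-injective (×-≡,≡→≡ (punchOut-injective (avoids x ∘ ≡.sym) (avoids y ∘ ≡.sym) p , q))

injective-not-constant⇒≤ : ∀ {a K b B} (F : Fin a → Fin K → Fin b × Fin B) →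
                           (∀ {x y} → F x ≗ F y → x ≡ y) →
                           (c : Fin b) → (∀ x → ¬ (∀ j → proj₁ (F x j) ≡ c)) →
                           a ≤ (b ^ K ∸ 1) * B ^ K
injective-not-constant⇒≤ {a} {K} {b} {B} F F-injective c not-constant =
  injective-avoiding⇒≤ encode encode-injective (funToFin {K} (λ _ → c))
    (λ x eq → not-constant x (funToFin-injective {K} eq))
  where
  encode : Fin a → Fin (b ^ K) × Fin (B ^ K)
  encode x = funToFin (proj₁ ∘ F x) , funToFin (proj₂ ∘ F x)

  encode-injective : Injective _≡_ _≡_ encode
  encode-injective eq = F-injective λ j →
    ×-≡,≡→≡ (funToFin-injective (≡.cong proj₁ eq) j , funToFin-injective (≡.cong proj₂ eq) j)

module IdealCongruence {c ℓ} (R : CommutativeRing c ℓ) {I : Pred (CommutativeRing.Carrier R) (c ⊔ ℓ)}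
                       (I-ideal : IsIdeal R I) where
  open CommutativeRing R renaming (_*_ to _·_) hiding (zero)
  open IsIdeal I-ideal
  open import Algebra.Properties.Ring ring using (-1*x≈-x)
  open import Algebra.Properties.AbelianGroup +-abelianGroup using (⁻¹-anti-homo‿-)
  open import Algebra.Properties.Group +-group using (\\-leftDividesʳ; //-rightDividesʳ; ε⁻¹≈ε)
  open import Relation.Binary.Reasoning.Setoid setoid

  -‿cl : ∀ {x} → I x → I (- x)
  -‿cl {x} x∈I = resp (-1*x≈-x x) (*-cl (- 1#) x∈I)

  infix 4 _∼_
  _∼_ : Carrier → Carrier → Set (c ⊔ ℓ)
  x ∼ y = I (x - y)

  ∼-sym : ∀ {x y} → x ∼ y → y ∼ x
  ∼-sym {x} {y} x∼y = resp (⁻¹-anti-homo‿- x y) (-‿cl x∼y)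

  ∼-trans : ∀ {x y z} → x ∼ y → y ∼ z → x ∼ z
  ∼-trans {x} {y} {z} x∼y y∼z = resp telescope (+-cl x∼y y∼z)
    where
    telescope : (x - y) + (y - z) ≈ x - z
    telescope = begin
      (x - y) + (y - z)   ≈⟨ +-assoc x (- y) (y - z) ⟩
      x + (- y + (y - z)) ≈⟨ +-congˡ (\\-leftDividesʳ y (- z)) ⟩
      x - z               ∎

  x-0≈x : ∀ x → x - 0# ≈ x
  x-0≈x x = trans (+-congˡ ε⁻¹≈ε) (+-identityʳ x)

  ∼0⇒∈ : ∀ {x} → x ∼ 0# → I x
  ∼0⇒∈ {x} = resp (x-0≈x x)

  ∈⇒∼0 : ∀ {x} → I x → x ∼ 0#
  ∈⇒∼0 {x} = resp (sym (x-0≈x x))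

  +-∈-∼ : ∀ {x y} → I y → x + y ∼ x
  +-∈-∼ {x} {y} y∈I = resp (sym (trans (+-congʳ (+-comm x y)) (//-rightDividesʳ x y))) y∈I

module ChainRing {c ℓ} (R : CommutativeRing c ℓ) (chain : IsChainRing R) where
  open CommutativeRing R renaming (_*_ to _·_) hiding (zero)
  open import Algebra.Properties.Semiring.Divisibility semiring using (_∣_; _,_; ∣ʳ-refl; ∣ʳ-respʳ-≈)
  open import Algebra.Properties.CommutativeSemigroup *-commutativeSemigroup using (x∙yz≈y∙xz)
  open import Relation.Binary.Reasoning.Setoid setoid

  ∣-isIdeal : ∀ a → IsIdeal R (a ∣_)
  ∣-isIdeal a = record
    { resp  = ∣ʳ-respʳ-≈
    ; zero∈ = 0# , zeroˡ a
    ; +-cl  = λ { (x , xa≈) (y , ya≈) → x + y , trans (distribʳ a x y) (+-cong xa≈ ya≈) }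
    ; *-cl  = λ { r (x , xa≈) → r · x , trans (*-assoc r x a) (*-congˡ xa≈) }
    }

  ∣-total : ∀ a b → a ∣ b ⊎ b ∣ a
  ∣-total a b with chain (a ∣_) (b ∣_) (∣-isIdeal a) (∣-isIdeal b)
  ... | inj₁ a∣⊆b∣ = inj₂ (a∣⊆b∣ ∣ʳ-refl)
  ... | inj₂ b∣⊆a∣ = inj₁ (b∣⊆a∣ ∣ʳ-refl)

  record CommonFactor {k} (a : Fin (suc k) → Carrier) : Set (c ⊔ ℓ) where
    field
      index          : Fin (suc k)
      cofactor       : Fin (suc k) → Carrier
      cofactor-index : cofactor index ≈ 1#
      factorises     : ∀ i → cofactor i · a index ≈ a i

  open CommonFactor public

  commonFactor : ∀ {k} (a : Fin (suc k) → Carrier) → CommonFactor a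
  commonFactor {zero} a = record
    { index = zero ; cofactor = λ _ → 1# ; cofactor-index = refl
    ; factorises = λ { zero → *-identityˡ (a zero) } }
  commonFactor {suc k} a = extend (commonFactor (a ∘ suc))
    where
    extend : CommonFactor (a ∘ suc) → CommonFactor a
    extend cf with ∣-total (a zero) (a (suc (index cf)))
    ... | inj₁ (t , ta₀≈aₘ) = record
      { index = zero ; cofactor = 1# ∷ (λ i → cofactor cf i · t) ; cofactor-index = refl
      ; factorises = λ
        { zero    → *-identityˡ (a zero)
        ; (suc i) → trans (*-assoc (cofactor cf i) t (a zero))
                          (trans (*-congˡ ta₀≈aₘ) (factorises cf i)) } }
    ... | inj₂ (t , taₘ≈a₀) = record
      { index = suc (index cf) ; cofactor = t ∷ cofactor cf ; cofactor-index = cofactor-index cf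
      ; factorises = λ { zero → taₘ≈a₀ ; (suc i) → factorises cf i } }

  finite-decidable-ideal-principal : IsFiniteRing R → ∀ {I} → IsIdeal R I → Decidable I →
                                     ∃[ π ] I π × (∀ {x} → I x → π ∣ x)
  finite-decidable-ideal-principal (N , enum , onto) {I} I-ideal I? =
    members (index cf) , members-∈ (index cf) , divides
    where
    open IsIdeal I-ideal

    restrict : Carrier → Carrier
    restrict x with I? x
    ... | yes _ = x
    ... | no  _ = 0#

    restrict-∈ : ∀ x → I (restrict x)
    restrict-∈ x with I? x
    ... | yes x∈I = x∈I
    ... | no  _   = zero∈

    restrict-≈ : ∀ {x} → I x → restrict x ≈ x
    restrict-≈ {x} x∈I with I? x
    ... | yes _   = refl
    ... | no  x∉I = ⊥-elim (x∉I x∈I)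

    members : Fin (suc N) → Carrier
    members = 0# ∷ restrict ∘ enum

    members-∈ : ∀ i → I (members i)
    members-∈ zero    = zero∈
    members-∈ (suc i) = restrict-∈ (enum i)

    cf : CommonFactor members
    cf = commonFactor members

    divides : ∀ {x} → I x → members (index cf) ∣ x
    divides {x} x∈I with i , enum-i≈x ← onto x =
      cofactor cf (suc i) ,
      trans (factorises cf (suc i)) (trans (restrict-≈ (resp (sym enum-i≈x) x∈I)) enum-i≈x)

  module _ {𝔪 : Pred Carrier (c ⊔ ℓ)} (𝔪-maximal : IsMaximalIdeal R 𝔪) where
    open IsMaximalIdeal 𝔪-maximal

    ∉𝔪⇒∣1 : ∀ {u} → ¬ 𝔪 u → u ∣ 1#
    ∉𝔪⇒∣1 {u} u∉𝔪 with chain (u ∣_) 𝔪 (∣-isIdeal u) ideal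
    ... | inj₁ u∣⊆𝔪 = ⊥-elim (u∉𝔪 (u∣⊆𝔪 ∣ʳ-refl))
    ... | inj₂ 𝔪⊆u∣ with maximal (u ∣_) (∣-isIdeal u) 𝔪⊆u∣
    ...   | inj₁ u∣⊆𝔪 = ⊥-elim (u∉𝔪 (u∣⊆𝔪 ∣ʳ-refl))
    ...   | inj₂ u∣1  = u∣1

    ∉𝔪-cancelʳ : ∀ {u x} → ¬ 𝔪 u → x · u ≈ 0# → x ≈ 0#
    ∉𝔪-cancelʳ {u} {x} u∉𝔪 xu≈0 with w , wu≈1 ← ∉𝔪⇒∣1 u∉𝔪 = begin
      x           ≈⟨ *-identityʳ x ⟨
      x · 1#      ≈⟨ *-congˡ wu≈1 ⟨
      x · (w · u) ≈⟨ x∙yz≈y∙xz x w u ⟩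
      w · (x · u) ≈⟨ *-congˡ xu≈0 ⟩
      w · 0#      ≈⟨ zeroʳ w ⟩
      0#          ∎

module LinearCombination {c ℓ} (R : CommutativeRing c ℓ) where
  open CommutativeRing R renaming (_*_ to _·_) hiding (zero)
  open import Algebra.Properties.Semiring.Sum semiring
    using (sum; sum-cong-≋; sum-replicate-zero; ∑-distrib-+; ∑-comm; *-distribˡ-sum)
  open import Algebra.Properties.CommutativeSemigroup *-commutativeSemigroup using (x∙yz≈y∙xz)
  open import Relation.Binary.Reasoning.Setoid setoid

  infix 4 ⟪_,_⟫
  ⟪_,_⟫ : ∀ {n} → (Fin n → Carrier) → (Fin n → Carrier) → Carrier
  ⟪ α , u ⟫ = Σᶠ R (λ e → α e · u e)

  Σᶠ≡sum : ∀ {t} (f : Fin t → Carrier) → Σᶠ R f ≡ sum f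
  Σᶠ≡sum {zero}  f = ≡.refl
  Σᶠ≡sum {suc t} f = ≡.cong (f zero +_) (Σᶠ≡sum (f ∘ suc))

  ⟪⟫≈sum : ∀ {n} (α u : Fin n → Carrier) → ⟪ α , u ⟫ ≈ sum (λ e → α e · u e)
  ⟪⟫≈sum α u = reflexive (Σᶠ≡sum (λ e → α e · u e))

  ⟪⟫-cong : ∀ {n} {α α′ u u′ : Fin n → Carrier} → (∀ e → α e ≈ α′ e) → (∀ e → u e ≈ u′ e) →
            ⟪ α , u ⟫ ≈ ⟪ α′ , u′ ⟫
  ⟪⟫-cong {α = α} {α′} {u} {u′} α≈α′ u≈u′ = begin
    ⟪ α , u ⟫                 ≈⟨ ⟪⟫≈sum α u ⟩
    sum (λ e → α e · u e)     ≈⟨ sum-cong-≋ (λ e → *-cong (α≈α′ e) (u≈u′ e)) ⟩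
    sum (λ e → α′ e · u′ e)   ≈⟨ ⟪⟫≈sum α′ u′ ⟨
    ⟪ α′ , u′ ⟫               ∎

  ⟪⟫-zeroˡ : ∀ {n} (u : Fin n → Carrier) → ⟪ (λ _ → 0#) , u ⟫ ≈ 0#
  ⟪⟫-zeroˡ {n} u = trans (⟪⟫≈sum _ u) (trans (sum-cong-≋ (λ e → zeroˡ (u e))) (sum-replicate-zero n))

  ⟪⟫-zeroʳ : ∀ {n} (α : Fin n → Carrier) → ⟪ α , (λ _ → 0#) ⟫ ≈ 0#
  ⟪⟫-zeroʳ {n} α = trans (⟪⟫≈sum α _) (trans (sum-cong-≋ (λ e → zeroʳ (α e))) (sum-replicate-zero n))

  ⟪⟫-distribʳ-+ : ∀ {n} (α β u : Fin n → Carrier) → ⟪ (λ e → α e + β e) , u ⟫ ≈ ⟪ α , u ⟫ + ⟪ β , u ⟫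
  ⟪⟫-distribʳ-+ α β u = begin
    ⟪ (λ e → α e + β e) , u ⟫                         ≈⟨ ⟪⟫≈sum _ u ⟩
    sum (λ e → (α e + β e) · u e)                     ≈⟨ sum-cong-≋ (λ e → distribʳ (u e) (α e) (β e)) ⟩
    sum (λ e → α e · u e + β e · u e)                 ≈⟨ ∑-distrib-+ (λ e → α e · u e) (λ e → β e · u e) ⟩
    sum (λ e → α e · u e) + sum (λ e → β e · u e)     ≈⟨ +-cong (⟪⟫≈sum α u) (⟪⟫≈sum β u) ⟨
    ⟪ α , u ⟫ + ⟪ β , u ⟫                             ∎

  ⟪⟫-*ˡ : ∀ {n} x (α u : Fin n → Carrier) → ⟪ (λ e → x · α e) , u ⟫ ≈ x · ⟪ α , u ⟫
  ⟪⟫-*ˡ x α u = begin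
    ⟪ (λ e → x · α e) , u ⟫       ≈⟨ ⟪⟫≈sum _ u ⟩
    sum (λ e → x · α e · u e)     ≈⟨ sum-cong-≋ (λ e → *-assoc x (α e) (u e)) ⟩
    sum (λ e → x · (α e · u e))   ≈⟨ *-distribˡ-sum x (λ e → α e · u e) ⟨
    x · sum (λ e → α e · u e)     ≈⟨ *-congˡ (⟪⟫≈sum α u) ⟨
    x · ⟪ α , u ⟫                 ∎

  ⟪⟫-lin : ∀ {n t} (α : Fin n → Carrier) (β : Fin t → Carrier) (v : Fin t → Vecᴿ R n) →
           ⟪ α , lin R β v ⟫ ≈ ⟪ β , (λ i → ⟪ α , v i ⟫) ⟫
  ⟪⟫-lin α β v = begin
    ⟪ α , lin R β v ⟫                              ≈⟨ ⟪⟫-cong (λ _ → refl) (λ e → ⟪⟫≈sum β (λ i → v i e)) ⟩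
    ⟪ α , (λ e → sum (λ i → β i · v i e)) ⟫        ≈⟨ ⟪⟫≈sum α _ ⟩
    sum (λ e → α e · sum (λ i → β i · v i e))
      ≈⟨ sum-cong-≋ (λ e → *-distribˡ-sum (α e) (λ i → β i · v i e)) ⟩
    sum (λ e → sum (λ i → α e · (β i · v i e)))
      ≈⟨ ∑-comm (λ e i → α e · (β i · v i e)) ⟩
    sum (λ i → sum (λ e → α e · (β i · v i e)))
      ≈⟨ sum-cong-≋ (λ i → sum-cong-≋ (λ e → x∙yz≈y∙xz (α e) (β i) (v i e))) ⟩
    sum (λ i → sum (λ e → β i · (α e · v i e)))
      ≈⟨ sum-cong-≋ (λ i → *-distribˡ-sum (β i) (λ e → α e · v i e)) ⟨
    sum (λ i → β i · sum (λ e → α e · v i e))      ≈⟨ ⟪⟫≈sum β _ ⟨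
    ⟪ β , (λ i → sum (λ e → α e · v i e)) ⟫        ≈⟨ ⟪⟫-cong (λ _ → refl) (λ i → ⟪⟫≈sum α (v i)) ⟨
    ⟪ β , (λ i → ⟪ α , v i ⟫) ⟫                    ∎

  δ : ∀ {n} → Fin n → Fin n → Carrier
  δ zero    zero    = 1#
  δ zero    (suc j) = 0#
  δ (suc i) zero    = 0#
  δ (suc i) (suc j) = δ i j

  δ-diag : ∀ {n} (i : Fin n) → δ i i ≈ 1#
  δ-diag zero    = refl
  δ-diag (suc i) = δ-diag i

  δ-offdiag : ∀ {n} {i j : Fin n} → i ≢ j → δ i j ≈ 0#
  δ-offdiag {i = zero}  {zero}  i≢j = contradiction ≡.refl i≢j
  δ-offdiag {i = zero}  {suc j} i≢j = refl
  δ-offdiag {i = suc i} {zero}  i≢j = refl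
  δ-offdiag {i = suc i} {suc j} i≢j = δ-offdiag (i≢j ∘ ≡.cong suc)

  ⟪δ,⟫ : ∀ {n} (i : Fin n) (u : Fin n → Carrier) → ⟪ δ i , u ⟫ ≈ u i
  ⟪δ,⟫ zero    u = trans (+-cong (*-identityˡ (u zero)) (⟪⟫-zeroˡ (u ∘ suc))) (+-identityʳ (u zero))
  ⟪δ,⟫ (suc i) u = trans (+-cong (zeroˡ (u zero)) (⟪δ,⟫ i (u ∘ suc))) (+-identityˡ (u (suc i)))

  lin-∈ : ∀ {n t} {C : Pred (Vecᴿ R n) (c ⊔ ℓ)} → IsSubmodule R C →
          (α : Fin t → Carrier) {w : Fin t → Vecᴿ R n} → (∀ i → C (w i)) → C (lin R α w)
  lin-∈ {t = zero}  C-submodule α w∈C = IsSubmodule.zero∈ C-submodule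
  lin-∈ {t = suc t} C-submodule α w∈C =
    IsSubmodule.+-cl C-submodule (IsSubmodule.*-cl C-submodule (α zero) (w∈C zero))
                                 (lin-∈ C-submodule (α ∘ suc) (w∈C ∘ suc))

module SimpleColumns {c ℓ} (R : CommutativeRing c ℓ) {𝔪 : Pred (CommutativeRing.Carrier R) (c ⊔ ℓ)}
                     (𝔪-ideal : IsIdeal R 𝔪) (1∉𝔪 : ¬ 𝔪 (CommutativeRing.1# R))
                     {n t m : ℕ} (v : Fin t → Vecᴿ R n) (G : Fin m → Vecᴿ R n)
                     (G-spanned : ∀ r → ∃[ β ] _≈ᵛ_ R (G r) (lin R β v))
                     (simple : IsSimple (ModIndep R 𝔪 G)) where
  open CommutativeRing R renaming (_*_ to _·_) hiding (zero)
  open IsIdeal 𝔪-ideal using (resp)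
  open LinearCombination R
  open import Algebra.Properties.Ring ring using (-‿distribˡ-*)
  open import Algebra.Properties.Group +-group using (x≈y⇒x∙y⁻¹≈ε)
  open import Relation.Binary.Reasoning.Setoid setoid

  column-relation-transfer : ∀ α → (∀ i → ⟪ α , v i ⟫ ≈ 0#) → ∀ r → ⟪ α , G r ⟫ ≈ 0#
  column-relation-transfer α α⊥v r with β , G≈ ← G-spanned r = begin
    ⟪ α , G r ⟫                  ≈⟨ ⟪⟫-cong (λ _ → refl) G≈ ⟩
    ⟪ α , lin R β v ⟫            ≈⟨ ⟪⟫-lin α β v ⟩
    ⟪ β , (λ i → ⟪ α , v i ⟫) ⟫  ≈⟨ ⟪⟫-cong (λ _ → refl) α⊥v ⟩
    ⟪ β , (λ _ → 0#) ⟫           ≈⟨ ⟪⟫-zeroʳ β ⟩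
    0#                           ∎

  relation⇒¬indep : ∀ {I : Subset n} α → (∀ e → e ∉ I → α e ≈ 0#) → (∀ i → ⟪ α , v i ⟫ ≈ 0#) →
              ∀ {e} → e ∈ I → ¬ 𝔪 (α e) → ¬ ModIndep R 𝔪 G I
  relation⇒¬indep α α-support α⊥v e∈I αe∉𝔪 I-indep =
    αe∉𝔪 (I-indep α α-support (column-relation-transfer α α⊥v) _ e∈I)

  ∉⁅⁆⇒≢ : ∀ {e j : Fin n} → j ∉ ⁅ e ⁆ → e ≢ j
  ∉⁅⁆⇒≢ {e} j∉⁅e⁆ e≡j = j∉⁅e⁆ (≡.subst (_∈ ⁅ e ⁆) e≡j (x∈⁅x⁆ e))

  column-nonzero : ∀ e → ¬ (∀ i → v i e ≈ 0#)
  column-nonzero e column≈0 = proj₁ simple e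
    (relation⇒¬indep (δ e) (λ j j∉⁅e⁆ → δ-offdiag (∉⁅⁆⇒≢ j∉⁅e⁆)) (λ i → trans (⟪δ,⟫ e (v i)) (column≈0 i))
               (x∈⁅x⁆ e) (1∉𝔪 ∘ resp (δ-diag e)))

  columns-not-proportional : ∀ {e f} → e ≢ f → ∀ {A B} → ¬ 𝔪 A → ¬ (∀ i → A · v i e ≈ B · v i f)
  columns-not-proportional {e} {f} e≢f {A} {B} A∉𝔪 proportional =
    proj₁ simple e λ e-indep → proj₁ simple f λ f-indep →
    proj₂ simple e f (e≢f , pair-dependent , e-indep , f-indep)
    where
    α : Fin n → Carrier
    α j = A · δ e j + - B · δ f j

    ⟪α,⟫ : ∀ u → ⟪ α , u ⟫ ≈ A · u e - B · u f
    ⟪α,⟫ u = begin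
      ⟪ α , u ⟫
        ≈⟨ ⟪⟫-distribʳ-+ _ _ u ⟩
      ⟪ (λ j → A · δ e j) , u ⟫ + ⟪ (λ j → - B · δ f j) , u ⟫
        ≈⟨ +-cong (⟪⟫-*ˡ A (δ e) u) (⟪⟫-*ˡ (- B) (δ f) u) ⟩
      A · ⟪ δ e , u ⟫ + - B · ⟪ δ f , u ⟫
        ≈⟨ +-cong (*-congˡ (⟪δ,⟫ e u)) (*-congˡ (⟪δ,⟫ f u)) ⟩
      A · u e + - B · u f
        ≈⟨ +-congˡ (-‿distribˡ-* B (u f)) ⟨
      A · u e - B · u f
        ∎

    α-support : ∀ j → j ∉ ⁅ e ⁆ ∪ ⁅ f ⁆ → α j ≈ 0#
    α-support j j∉ = begin
      A · δ e j + - B · δ f j ≈⟨ +-cong (*-congˡ (δ-offdiag (∉⁅⁆⇒≢ (j∉ ∘ x∈p∪q⁺ ∘ inj₁))))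
                                        (*-congˡ (δ-offdiag (∉⁅⁆⇒≢ (j∉ ∘ x∈p∪q⁺ ∘ inj₂)))) ⟩
      A · 0# + - B · 0#       ≈⟨ +-cong (zeroʳ A) (zeroʳ (- B)) ⟩
      0# + 0#                 ≈⟨ +-identityʳ 0# ⟩
      0#                      ∎

    αe≈A : α e ≈ A
    αe≈A = begin
      A · δ e e + - B · δ f e ≈⟨ +-cong (*-congˡ (δ-diag e)) (*-congˡ (δ-offdiag (e≢f ∘ ≡.sym))) ⟩
      A · 1# + - B · 0#       ≈⟨ +-cong (*-identityʳ A) (zeroʳ (- B)) ⟩
      A + 0#                  ≈⟨ +-identityʳ A ⟩
      A                       ∎

    pair-dependent : ¬ ModIndep R 𝔪 G (⁅ e ⁆ ∪ ⁅ f ⁆)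
    pair-dependent = relation⇒¬indep α α-support (λ i → trans (⟪α,⟫ (v i)) (x≈y⇒x∙y⁻¹≈ε (proportional i)))
                               (x∈p∪q⁺ (inj₁ (x∈⁅x⁆ e))) (A∉𝔪 ∘ resp αe≈A)

module FiniteChainRing {c ℓ} (R : CommutativeRing c ℓ) (𝔪 : Pred (CommutativeRing.Carrier R) (c ⊔ ℓ))
  (finite : IsFiniteRing R) (chain : IsChainRing R) (𝔪-maximal : IsMaximalIdeal R 𝔪)
  (q′ : ℕ) (residues : ResidueFieldCard R 𝔪 (suc q′))
  (ν′ : ℕ) (nilpotent : NilpotencyIndex R 𝔪 (suc ν′)) where

  open CommutativeRing R renaming (_*_ to _·_) hiding (zero)
  open ChainRing R chain
  open LinearCombination R
  open IsMaximalIdeal 𝔪-maximal using (ideal; proper)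
  open IsIdeal ideal
  open IdealCongruence R ideal
  open import Algebra.Properties.Ring ring using (+-cancelˡ; x[y-z]≈xy-xz)
  open import Algebra.Properties.Group +-group using (//-rightDividesˡ; x≈y⇒x∙y⁻¹≈ε)
  open import Algebra.Properties.Semiring.Divisibility semiring
    using (_∣_; _,_; ∣ʳ-refl; ∣ʳ-respˡ-≈; 0∣x⇒x≈0)
  open import Algebra.Properties.CommutativeSemigroup *-commutativeSemigroup using (x∙yz≈yx∙z; interchange)
  open import Algebra.Properties.CommutativeSemigroup.Divisibility *-commutativeSemigroup using (∙-cong-∣)
  open import Relation.Binary.Reasoning.Setoid setoid

  q ν : ℕ
  q = suc q′
  ν = suc ν′

  x≈y+[x-y] : ∀ x y → x ≈ y + (x - y)
  x≈y+[x-y] x y = trans (sym (//-rightDividesˡ y x)) (+-comm (x - y) y)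

  r : Fin q → Carrier
  r = proj₁ residues

  r-injective : ∀ {i j} → r i ∼ r j → i ≡ j
  r-injective = proj₁ (proj₂ residues) _ _

  res : Carrier → Fin q
  res x = proj₁ (proj₂ (proj₂ residues) x)

  ∼r[res] : ∀ x → x ∼ r (res x)
  ∼r[res] x = proj₂ (proj₂ (proj₂ residues) x)

  res-unique : ∀ {x i} → x ∼ r i → res x ≡ i
  res-unique {x} x∼rᵢ = r-injective (∼-trans (∼-sym (∼r[res] x)) x∼rᵢ)

  0̂ : Fin q
  0̂ = res 0#

  ∈𝔪⇒res≡0̂ : ∀ {x} → 𝔪 x → res x ≡ 0̂
  ∈𝔪⇒res≡0̂ x∈𝔪 = res-unique (∼-trans (∈⇒∼0 x∈𝔪) (∼r[res] 0#))

  res≡0̂⇒∈𝔪 : ∀ {x} → res x ≡ 0̂ → 𝔪 x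
  res≡0̂⇒∈𝔪 {x} res-x≡0̂ =
    ∼0⇒∈ (∼-trans (∼r[res] x) (≡.subst (λ i → r i ∼ 0#) (≡.sym res-x≡0̂) (∼-sym (∼r[res] 0#))))

  𝔪? : Decidable 𝔪
  𝔪? x = map′ res≡0̂⇒∈𝔪 ∈𝔪⇒res≡0̂ (res x ≟ 0̂)

  opaque
    π : Carrier
    π = proj₁ (finite-decidable-ideal-principal finite ideal 𝔪?)

    π∈𝔪 : 𝔪 π
    π∈𝔪 = proj₁ (proj₂ (finite-decidable-ideal-principal finite ideal 𝔪?))

    π∣ : ∀ {x} → 𝔪 x → π ∣ x
    π∣ = proj₂ (proj₂ (finite-decidable-ideal-principal finite ideal 𝔪?))

  π-divides : ∀ {x} → 𝔪 x → ∃[ y ] x ≈ π · y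
  π-divides x∈𝔪 with y , yπ≈x ← π∣ x∈𝔪 = y , trans (sym yπ≈x) (*-comm y π)

  π·-∈𝔪 : ∀ x → 𝔪 (π · x)
  π·-∈𝔪 x = resp (*-comm x π) (*-cl x π∈𝔪)

  π^_ : ℕ → Carrier
  π^ t = Πᶠ R {t} (λ _ → π)

  π^ν≈0 : π^ ν ≈ 0#
  π^ν≈0 = proj₁ nilpotent (λ _ → π) (λ _ → π∈𝔪)

  π^ν·≈0 : ∀ x → π^ ν · x ≈ 0#
  π^ν·≈0 x = trans (*-congʳ π^ν≈0) (zeroˡ x)

  π^∣Πᶠ : ∀ {t} (xs : Fin t → Carrier) → (∀ i → 𝔪 (xs i)) → π^ t ∣ Πᶠ R xs
  π^∣Πᶠ {zero}  xs xs∈𝔪 = ∣ʳ-refl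
  π^∣Πᶠ {suc t} xs xs∈𝔪 = ∙-cong-∣ (π∣ (xs∈𝔪 zero)) (π^∣Πᶠ (xs ∘ suc) (xs∈𝔪 ∘ suc))

  π^≈0⇒ν≤ : ∀ t → π^ t ≈ 0# → ν ≤ t
  π^≈0⇒ν≤ t π^t≈0 = proj₂ nilpotent t λ xs xs∈𝔪 → 0∣x⇒x≈0 (∣ʳ-respˡ-≈ π^t≈0 (π^∣Πᶠ xs xs∈𝔪))

  π^·∉𝔪≉0 : ∀ {t u} → t < ν → ¬ 𝔪 u → ¬ (π^ t · u ≈ 0#)
  π^·∉𝔪≉0 {t} t<ν u∉𝔪 π^t·u≈0 = ℕₚ.<⇒≱ t<ν (π^≈0⇒ν≤ t (∉𝔪-cancelʳ 𝔪-maximal u∉𝔪 π^t·u≈0))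

  Digits : ℕ → Set
  Digits j = Fin j → Fin q

  val : ∀ {j} → Digits j → Carrier
  val {zero}  ds = 0#
  val {suc j} ds = r (ds zero) + π · val (ds ∘ suc)

  val-cong : ∀ {j} {ds ds′ : Digits j} → ds ≗ ds′ → val ds ≈ val ds′
  val-cong {zero}  ds≗ds′ = refl
  val-cong {suc j} ds≗ds′ = +-cong (reflexive (≡.cong r (ds≗ds′ zero))) (*-congˡ (val-cong (ds≗ds′ ∘ suc)))

  val∼head : ∀ {j} (ds : Digits (suc j)) → val ds ∼ r (ds zero)
  val∼head ds = +-∈-∼ (π·-∈𝔪 (val (ds ∘ suc)))

  expansion : ∀ x → ∃[ y ] x ≈ r (res x) + π · y
  expansion x with y , x-r≈πy ← π-divides (∼r[res] x) =
    y , trans (x≈y+[x-y] x (r (res x))) (+-congˡ x-r≈πy)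

  quot : Carrier → Carrier
  quot x = proj₁ (expansion x)

  digits : ∀ j → Carrier → Digits j
  digits zero    x = λ ()
  digits (suc j) x = res x ∷ digits j (quot x)

  val-digits : ∀ j x → ∃[ y ] x ≈ val (digits j x) + π^ j · y
  val-digits zero    x = x , sym (trans (+-identityˡ _) (*-identityˡ x))
  val-digits (suc j) x with y , quot≈ ← val-digits j (quot x) = y , (begin
    x                                    ≈⟨ proj₂ (expansion x) ⟩
    r (res x) + π · quot x               ≈⟨ +-congˡ (*-congˡ quot≈) ⟩
    r (res x) + π · (V + π^ j · y)       ≈⟨ +-congˡ (distribˡ π V (π^ j · y)) ⟩
    r (res x) + (π · V + π · (π^ j · y)) ≈⟨ +-assoc _ _ _ ⟨
    r (res x) + π · V + π · (π^ j · y)   ≈⟨ +-congˡ (*-assoc π (π^ j) y) ⟨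
    r (res x) + π · V + π^ suc j · y     ∎)
    where
    V : Carrier
    V = val (digits j (quot x))

  val-digits-ν : ∀ x → x ≈ val (digits ν x)
  val-digits-ν x with y , x≈ ← val-digits ν x = begin
    x                           ≈⟨ x≈ ⟩
    val (digits ν x) + π^ ν · y ≈⟨ +-congˡ (π^ν·≈0 y) ⟩
    val (digits ν x) + 0#       ≈⟨ +-identityʳ _ ⟩
    val (digits ν x)            ∎

  digits-injective : ∀ {x y} → digits ν x ≗ digits ν y → x ≈ y
  digits-injective {x} {y} eq = trans (val-digits-ν x) (trans (val-cong eq) (sym (val-digits-ν y)))

  π^·val-head : ∀ {t j} → t < ν → {ds ds′ : Digits (suc j)} →
                π^ t · val ds ≈ π^ t · val ds′ → ds zero ≡ ds′ zero
  π^·val-head {t} t<ν {ds} {ds′} eq with ds zero ≟ ds′ zero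
  ... | yes heads≡ = heads≡
  ... | no  heads≢ = contradiction π^t·diff≈0 (π^·∉𝔪≉0 t<ν diff∉𝔪)
    where
    diff∉𝔪 : ¬ 𝔪 (val ds - val ds′)
    diff∉𝔪 vals∼ = heads≢ (r-injective (∼-trans (∼-sym (val∼head ds)) (∼-trans vals∼ (val∼head ds′))))

    π^t·diff≈0 : π^ t · (val ds - val ds′) ≈ 0#
    π^t·diff≈0 = trans (x[y-z]≈xy-xz _ _ _) (x≈y⇒x∙y⁻¹≈ε eq)

  -- π is a zero divisor, so after the leading digits agree the remaining ones can only be compared
  -- inside π^(t+1)·R: hence the factor π^t.
  π^·val-injective : ∀ {j} t → t ℕ.+ j ≤ ν → {ds ds′ : Digits j} →
                     π^ t · val ds ≈ π^ t · val ds′ → ds ≗ ds′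
  π^·val-injective {zero}  t _ _ ()
  π^·val-injective {suc j} t t+j≤ν {ds} {ds′} eq = λ { zero → heads≡ ; (suc i) → tails≗ i }
    where
    1+t+j≤ν : suc t ℕ.+ j ≤ ν
    1+t+j≤ν = ≡.subst (_≤ ν) (ℕₚ.+-suc t j) t+j≤ν

    heads≡ : ds zero ≡ ds′ zero
    heads≡ = π^·val-head (ℕₚ.m+n≤o⇒m≤o (suc t) 1+t+j≤ν) {ds} {ds′} eq

    A A′ : Carrier
    A  = val (ds ∘ suc)
    A′ = val (ds′ ∘ suc)

    tails : π^ suc t · A ≈ π^ suc t · A′
    tails = begin
      π^ suc t · A   ≈⟨ x∙yz≈yx∙z (π^ t) π A ⟨
      π^ t · (π · A) ≈⟨ +-cancelˡ (π^ t · r (ds zero)) _ _ (begin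
        π^ t · r (ds zero) + π^ t · (π · A)   ≈⟨ distribˡ _ _ _ ⟨
        π^ t · val ds                         ≈⟨ eq ⟩
        π^ t · val ds′                        ≈⟨ distribˡ _ _ _ ⟩
        π^ t · r (ds′ zero) + π^ t · (π · A′) ≈⟨ +-congʳ (*-congˡ (reflexive (≡.cong r heads≡))) ⟨
        π^ t · r (ds zero) + π^ t · (π · A′)  ∎) ⟩
      π^ t · (π · A′) ≈⟨ x∙yz≈yx∙z (π^ t) π A′ ⟩
      π^ suc t · A′   ∎

    tails≗ : ds ∘ suc ≗ ds′ ∘ suc
    tails≗ = π^·val-injective (suc t) 1+t+j≤ν tails

  val-injective : ∀ {ds ds′ : Digits ν} → val ds ≈ val ds′ → ds ≗ ds′
  val-injective eq = π^·val-injective 0 ℕₚ.≤-refl (trans (*-identityˡ _) (trans eq (sym (*-identityˡ _))))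

  unit : Fin q′ → Fin (q ^ ν′) → Carrier
  unit d t = val (punchIn 0̂ d ∷ finToFun {q} {ν′} t)

  unit∉𝔪 : ∀ d t → ¬ 𝔪 (unit d t)
  unit∉𝔪 d t unit∈𝔪 = punchInᵢ≢i 0̂ d (≡.trans (≡.sym leading-digit) (∈𝔪⇒res≡0̂ unit∈𝔪))
    where
    leading-digit : res (unit d t) ≡ punchIn 0̂ d
    leading-digit = res-unique (val∼head (punchIn 0̂ d ∷ finToFun {q} {ν′} t))

  unit-injective : ∀ {d t d′ t′} → unit d t ≈ unit d′ t′ → d ≡ d′ × t ≡ t′
  unit-injective {d} {t} {d′} {t′} eq =
    punchIn-injective 0̂ d d′ (digits≗ zero) , finToFun-injective {q} {ν′} (digits≗ ∘ suc)
    where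
    digits≗ : punchIn 0̂ d ∷ finToFun {q} {ν′} t ≗ punchIn 0̂ d′ ∷ finToFun t′
    digits≗ = val-injective eq

  split : Carrier → Fin q × Fin (q ^ ν′)
  split x = res x , funToFin (digits ν′ (quot x))

  split-injective : ∀ {x y} → split x ≡ split y → x ≈ y
  split-injective eq = digits-injective λ
    { zero    → ≡.cong proj₁ eq
    ; (suc i) → funToFin-injective (≡.cong proj₂ eq) i
    }

  module Nakayama {n : ℕ} {C : Pred (Vecᴿ R n) (c ⊔ ℓ)} (C-submodule : IsSubmodule R C)
                  {k : ℕ} {v : Fin k → Vecᴿ R n}
                  (spans-mod-𝔪C : ∀ u → C u → ∃[ α ] In𝔪C R 𝔪 C (λ e → u e - lin R α v e)) where

    𝔪C⊆πC : ∀ {x} → In𝔪C R 𝔪 C x → ∃[ w ] C w × (∀ e → x e ≈ π · w e)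
    𝔪C⊆πC {x} (t , a , w , a∈𝔪 , w∈C , x≈) = lin R b w , lin-∈ C-submodule b w∈C , λ e → begin
      x e                        ≈⟨ x≈ e ⟩
      lin R a w e                ≈⟨ ⟪⟫-cong (λ i → proj₂ (π-divides (a∈𝔪 i))) (λ _ → refl) ⟩
      lin R (λ i → π · b i) w e  ≈⟨ ⟪⟫-*ˡ π b (λ i → w i e) ⟩
      π · lin R b w e            ∎
      where
      b : Fin t → Carrier
      b i = proj₁ (π-divides (a∈𝔪 i))

    spans-mod-π : ∀ {u} → C u → ∃[ α ] ∃[ w ] C w × (∀ e → u e ≈ lin R α v e + π · w e)
    spans-mod-π {u} u∈C with α , u-αv∈𝔪C ← spans-mod-𝔪C u u∈C with w , w∈C , u-αv≈πw ← 𝔪C⊆πC u-αv∈𝔪C =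
      α , w , w∈C , λ e → trans (x≈y+[x-y] (u e) (lin R α v e)) (+-congˡ (u-αv≈πw e))

    spans-mod-π^ : ∀ j {u} → C u → ∃[ β ] ∃[ w ] C w × (∀ e → u e ≈ lin R β v e + π^ j · w e)
    spans-mod-π^ zero {u} u∈C =
      (λ _ → 0#) , u , u∈C , λ e →
      sym (trans (+-cong (⟪⟫-zeroˡ (λ i → v i e)) (*-identityˡ (u e))) (+-identityˡ (u e)))
    spans-mod-π^ (suc j) {u} u∈C
      with β , w , w∈C , u≈ ← spans-mod-π^ j u∈C with α , w′ , w′∈C , w≈ ← spans-mod-π w∈C =
      (λ i → β i + π^ j · α i) , w′ , w′∈C , λ e → begin
        u e
          ≈⟨ u≈ e ⟩
        lin R β v e + π^ j · w e
          ≈⟨ +-congˡ (*-congˡ (w≈ e)) ⟩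
        lin R β v e + π^ j · (lin R α v e + π · w′ e)
          ≈⟨ +-congˡ (distribˡ _ _ _) ⟩
        lin R β v e + (π^ j · lin R α v e + π^ j · (π · w′ e))
          ≈⟨ +-assoc _ _ _ ⟨
        lin R β v e + π^ j · lin R α v e + π^ j · (π · w′ e)
          ≈⟨ +-cong (+-congˡ (⟪⟫-*ˡ (π^ j) α (λ i → v i e))) (sym (x∙yz≈yx∙z (π^ j) π (w′ e))) ⟨
        lin R β v e + lin R (λ i → π^ j · α i) v e + π^ suc j · w′ e
          ≈⟨ +-congʳ (⟪⟫-distribʳ-+ β _ _) ⟨
        lin R (λ i → β i + π^ j · α i) v e + π^ suc j · w′ e
          ∎

    spans : ∀ {u} → C u → ∃[ β ] (∀ e → u e ≈ lin R β v e)
    spans {u} u∈C with β , w , _ , u≈ ← spans-mod-π^ ν u∈C = β , λ e → begin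
      u e                      ≈⟨ u≈ e ⟩
      lin R β v e + π^ ν · w e ≈⟨ +-congˡ (π^ν·≈0 (w e)) ⟩
      lin R β v e + 0#         ≈⟨ +-identityʳ _ ⟩
      lin R β v e              ∎

  module ColumnDirections {n k′ m : ℕ} (v : Fin (suc k′) → Vecᴿ R n) (G : Fin m → Vecᴿ R n)
              (G-spanned : ∀ r → ∃[ β ] (∀ e → G r e ≈ lin R β v e))
              (simple : IsSimple (ModIndep R 𝔪 G)) where
    open SimpleColumns R ideal proper v G G-spanned simple using (columns-not-proportional)

    column : (e : Fin n) → CommonFactor (λ i → v i e)
    column e = commonFactor (λ i → v i e)

    pivot : Fin n → Fin (suc k′)
    pivot e = index (column e)

    scale : Fin n → Carrier
    scale e = v (pivot e) e

    direction : Fin n → Fin (suc k′) → Carrier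
    direction e = cofactor (column e)

    proportional : ∀ {e f u u′} → (∀ i → u · direction e i ≈ u′ · direction f i) → scale f ∣ scale e →
                   ∃[ B ] (∀ i → u · v i e ≈ B · v i f)
    proportional {e} {f} {u} {u′} eq (t , t·sf≈se) = t · u′ , λ i → begin
      u · v i e                           ≈⟨ *-congˡ (factorises (column e) i) ⟨
      u · (direction e i · scale e)       ≈⟨ *-assoc _ _ _ ⟨
      u · direction e i · scale e         ≈⟨ *-cong (eq i) (sym t·sf≈se) ⟩
      u′ · direction f i · (t · scale f)  ≈⟨ interchange _ _ _ _ ⟩
      u′ · t · (direction f i · scale f)  ≈⟨ *-cong (*-comm u′ t) (factorises (column f) i) ⟩
      t · u′ · v i f                      ∎

    scaled-directions-injective : ∀ {e f u u′} → ¬ 𝔪 u → ¬ 𝔪 u′ →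
                                  (∀ i → u · direction e i ≈ u′ · direction f i) → e ≡ f × u ≈ u′
    scaled-directions-injective {e} {f} {u} {u′} u∉𝔪 u′∉𝔪 eq with e ≟ f
    ... | yes ≡.refl = ≡.refl , (begin
      u                          ≈⟨ *-identityʳ u ⟨
      u · 1#                     ≈⟨ *-congˡ (cofactor-index (column e)) ⟨
      u · direction e (pivot e)  ≈⟨ eq (pivot e) ⟩
      u′ · direction e (pivot e) ≈⟨ *-congˡ (cofactor-index (column e)) ⟩
      u′ · 1#                    ≈⟨ *-identityʳ u′ ⟩
      u′                         ∎)
    ... | no e≢f with ∣-total (scale e) (scale f)
    ...   | inj₁ se∣sf =
      ⊥-elim (columns-not-proportional (e≢f ∘ ≡.sym) u′∉𝔪 (proj₂ (proportional (sym ∘ eq) se∣sf)))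
    ...   | inj₂ sf∣se =
      ⊥-elim (columns-not-proportional e≢f u∉𝔪 (proj₂ (proportional eq sf∣se)))

    scaled : Fin n × Fin q′ × Fin (q ^ ν′) → Fin (suc k′) → Carrier
    scaled (e , d , t) i = unit d t · direction e i

    scaled-injective : ∀ {x y} → (∀ i → scaled x i ≈ scaled y i) → x ≡ y
    scaled-injective {e , d , t} {e′ , d′ , t′} eq
      with e≡e′ , u≈u′ ← scaled-directions-injective (unit∉𝔪 d t) (unit∉𝔪 d′ t′) eq
      with d≡d′ , t≡t′ ← unit-injective u≈u′ =
      ×-≡,≡→≡ (e≡e′ , ×-≡,≡→≡ (d≡d′ , t≡t′))

    scaled-∉𝔪 : ∀ x → ¬ (∀ i → 𝔪 (scaled x i))
    scaled-∉𝔪 (e , d , t) scaled∈𝔪 =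
      unit∉𝔪 d t (resp (trans (*-congˡ (cofactor-index (column e))) (*-identityʳ _)) (scaled∈𝔪 (pivot e)))

    decode : Fin (n * (q′ * q ^ ν′)) → Fin n × Fin q′ × Fin (q ^ ν′)
    decode x = map₂ (remQuot (q ^ ν′)) (remQuot (q′ * q ^ ν′) x)

    decode-injective : ∀ {x y} → decode x ≡ decode y → x ≡ y
    decode-injective eq = remQuot-injective {n} (q′ * q ^ ν′)
      (×-≡,≡→≡ (≡.cong proj₁ eq , remQuot-injective {q′} (q ^ ν′) (≡.cong proj₂ eq)))

    codeword : Fin (n * (q′ * q ^ ν′)) → Fin (suc k′) → Fin q × Fin (q ^ ν′)
    codeword x i = split (scaled (decode x) i)

    bound : n * (q′ * q ^ ν′) ≤ (q ^ suc k′ ∸ 1) * (q ^ ν′) ^ suc k′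
    bound = injective-not-constant⇒≤ codeword
      (λ eq → decode-injective (scaled-injective (λ i → split-injective (eq i))))
      0̂ (λ x res≡0̂ → scaled-∉𝔪 (decode x) (λ i → res≡0̂⇒∈𝔪 (res≡0̂ i)))

  columns-bound : ∀ {n k m} (v : Fin k → Vecᴿ R n) (G : Fin m → Vecᴿ R n) →
                  (∀ r → ∃[ β ] (∀ e → G r e ≈ lin R β v e)) → IsSimple (ModIndep R 𝔪 G) →
                  n * (q′ * q ^ ν′) ≤ (q ^ k ∸ 1) * (q ^ ν′) ^ k
  columns-bound {zero}          _ _ _         _      = z≤n
  columns-bound {suc n} {zero}  v G G-spanned simple =
    ⊥-elim (SimpleColumns.column-nonzero R ideal proper v G G-spanned simple zero (λ ()))
  columns-bound {k = suc k′}    v G G-spanned simple = ColumnDirections.bound v G G-spanned simple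

module _ {c ℓ} (R : CommutativeRing c ℓ) {𝔪 : Pred (CommutativeRing.Carrier R) (c ⊔ ℓ)} where
  open CommutativeRing R using (0#; sym)

  residue-field-nonempty : ¬ ResidueFieldCard R 𝔪 0
  residue-field-nonempty (_ , _ , complete) with () ← proj₁ (complete 0#)

  nilpotency-index-nonzero : IsMaximalIdeal R 𝔪 → ¬ NilpotencyIndex R 𝔪 0
  nilpotency-index-nonzero 𝔪-maximal (𝔪⁰≈0 , _) =
    proper (IsIdeal.resp ideal (sym (𝔪⁰≈0 (λ ()) (λ ()))) (IsIdeal.zero∈ ideal))
    where open IsMaximalIdeal 𝔪-maximal

geometric-difference : ∀ b m k → (b ^ k ∸ 1) * (b ^ m) ^ k ≡ b ^ (suc m * k) ∸ b ^ (m * k)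
geometric-difference b m k = begin
  (b ^ k ∸ 1) * (b ^ m) ^ k              ≡⟨ ℕₚ.*-distribʳ-∸ ((b ^ m) ^ k) (b ^ k) 1 ⟩
  b ^ k * (b ^ m) ^ k ∸ 1 * (b ^ m) ^ k  ≡⟨ ≡.cong₂ _∸_ (≡.cong (b ^ k *_) (ℕₚ.^-*-assoc b m k))
                                                       (≡.trans (ℕₚ.*-identityˡ _) (ℕₚ.^-*-assoc b m k)) ⟩
  b ^ k * b ^ (m * k) ∸ b ^ (m * k)      ≡⟨ ≡.cong (_∸ b ^ (m * k)) (ℕₚ.^-distribˡ-+-* b k (m * k)) ⟨
  b ^ (suc m * k) ∸ b ^ (m * k)          ∎
  where open ≡.≡-Reasoning

lemma5p4 : {c ℓ : Level} (R : CommutativeRing c ℓ) (𝔪 : Pred (CommutativeRing.Carrier R) (c ⊔ ℓ))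
    → IsFiniteRing R → IsChainRing R → IsMaximalIdeal R 𝔪
    → (q : ℕ) → ResidueFieldCard R 𝔪 q
    → (ν : ℕ) → NilpotencyIndex R 𝔪 ν
    → (n : ℕ) (C : Pred (Vecᴿ R n) (c ⊔ ℓ)) → IsSubmodule R C → IsFree R C
    → (k : ℕ) → Mu R 𝔪 C k
    → (m : ℕ) (G : Fin m → Vecᴿ R n) → IsMinimalGeneratorMatrix R C G
    → IsSimple (ModIndep R 𝔪 G)
    → n * (q ^ ν ∸ q ^ (ν ∸ 1)) ≤ q ^ (ν * k) ∸ q ^ ((ν ∸ 1) * k)
lemma5p4 R 𝔪 _ _ _ zero residues _ _ _ _ _ _ _ _ _ _ _ _ = ⊥-elim (residue-field-nonempty R {𝔪} residues)
lemma5p4 R _ _ _ 𝔪-maximal (suc _) _ zero nilpotent _ _ _ _ _ _ _ _ _ _ =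
  ⊥-elim (nilpotency-index-nonzero R 𝔪-maximal nilpotent)
lemma5p4 R 𝔪 finite chain 𝔪-maximal (suc q′) residues (suc ν′) nilpotent
         n C C-submodule _ k (v , _ , _ , spans-mod-𝔪C) m G G-minimal simple =
  ≡.subst₂ _≤_ (≡.cong (n *_) (≡.sym unit-count)) (geometric-difference (suc q′) ν′ k)
    (columns-bound v G (spans ∘ rows∈) simple)
  where
  unit-count : suc q′ ^ suc ν′ ∸ suc q′ ^ ν′ ≡ q′ * suc q′ ^ ν′
  unit-count = ℕₚ.m+n∸m≡n (suc q′ ^ ν′) (q′ * suc q′ ^ ν′)

  open FiniteChainRing R 𝔪 finite chain 𝔪-maximal q′ residues ν′ nilpotent
  open Nakayama C-submodule spans-mod-𝔪C
  open IsMinimalGeneratorMatrix G-minimal using (rows∈)
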